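{- Let $m\ge 1$ and let $\underline{r}=(r_1,\dots,r_m)$ be integers $r_i\ge 2$ that are pairwise coprime. For $n\ge 0$ let $CP_{\underline{r},n}$ be the set of partitions of $n$ none of whose parts is divisible by any of $r_1,\dots,r_m$. For a partition $\rho$ and $i\ge1$ let $m_i(\rho)$ be the multiplicity of $i$ as a part of $\rho$, and define for $j\ge 1$ $$V_{\underline{r},j,n}=\sum_{\rho\in CP_{\underline{r},n}} m_j(\rho),\qquad W_{\underline{r},j,n}=\sum_{\rho\in CP_{\underline{r},n}}\bigl|\{i\ge 1 \mid m_i(\rho)\ge j\}\bigr|.$$ If $j\ge 1$ is divisible by none of $r_1,\dots,r_m$, then $$V_{\underline{r},j,n}=\sum_{k_1,\dots,k_m\ge 0} W_{\underline{r},\,r_1^{k_1}r_2^{k_2}\cdots r_m^{k_m}j,\,n}.$$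
   Context: A partition is called $\underline{r}$-class regular if none of its parts is divisible by any $r_i$. -}

module Defs where

open import Data.Nat using (ℕ; zero; suc; _+_; _*_; _∸_; _^_; _≤_; _<_; _≤?_; _≟_)
open import Data.Nat.Divisibility using (_∣_; _∣?_)
open import Data.Fin using (Fin)
open import Data.List using (List; []; _∷_; map; concatMap; upTo; filter; length)
open import Data.Nat.ListAction using (sum)
open import Data.Vec.Functional using (head; tail) renaming (_∷_ to _∷ᵥ_)
open import Data.Product using (Σ; _×_; ∃)
open import Relation.Nullary using (¬_)
open import Relation.Nullary.Decidable using (¬?)
open import Relation.Binary.PropositionalEquality using (_≡_)
import Data.List.Relation.Unary.All
import Data.Fin.Properties
import Relation.Nullary

oneTo : ℕ → List ℕ
oneTo n = map suc (upTo n)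

-- partsBounded fuel k n : all partitions of n into parts each ≤ k, each partition
-- listed as a non-increasing list of positive integers.  fuel ≥ n suffices since
-- each step removes a part ≥ 1.
partsBounded : ℕ → ℕ → ℕ → List (List ℕ)
partsBounded _        k zero    = [] ∷ []
partsBounded zero     k (suc n) = []
partsBounded (suc f)  k (suc n) =
  concatMap (λ p → map (p ∷_) (partsBounded f p (suc n ∸ p)))
            (filter (λ p → p ≤? k) (oneTo (suc n)))

partitions : ℕ → List (List ℕ)
partitions n = partsBounded n n n

NotDivByAny : ∀ {m} → (Fin m → ℕ) → ℕ → Set
NotDivByAny r x = ∀ i → ¬ (r i ∣ x)

notDivByAny? : ∀ {m} (r : Fin m → ℕ) (x : ℕ) → Relation.Nullary.Dec (NotDivByAny r x)
notDivByAny? r x = Data.Fin.Properties.all? (λ i → ¬? (r i ∣? x))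

CP : ∀ {m} → (Fin m → ℕ) → ℕ → List (List ℕ)
CP r n = filter (λ ρ → Data.List.Relation.Unary.All.all? (notDivByAny? r) ρ) (partitions n)

mult : ℕ → List ℕ → ℕ
mult i ρ = length (filter (λ x → x ≟ i) ρ)

-- |{ i ≥ 1 | m_i(ρ) ≥ j }| for a partition ρ of n (parts of ρ lie in [1..n],
-- and m_i(ρ) = 0 for i > n, so for j ≥ 1 only i ∈ [1..n] can contribute)
numMultGe : ℕ → ℕ → List ℕ → ℕ
numMultGe n j ρ = length (filter (λ i → j ≤? mult i ρ) (oneTo n))

V : ∀ {m} → (Fin m → ℕ) → ℕ → ℕ → ℕ
V r j n = sum (map (mult j) (CP r n))

W : ∀ {m} → (Fin m → ℕ) → ℕ → ℕ → ℕ
W r j n = sum (map (numMultGe n j) (CP r n))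

prodPow : ∀ {m} → (Fin m → ℕ) → (Fin m → ℕ) → ℕ
prodPow {zero}  r k = 1
prodPow {suc m} r k = head r ^ head k * prodPow (tail r) (tail k)

boxSum : ∀ {m} → ℕ → ((Fin m → ℕ) → ℕ) → ℕ
boxSum {zero}  B f = f (λ ())
boxSum {suc m} B f = sum (map (λ a → boxSum B (λ k → f (a ∷ᵥ k))) (upTo (suc B)))

-- Σ_{k ∈ ℕ^m} f k = s  (f finitely supported, with sum s):
-- some box [0..B]^m contains the support of f and the sum over it is s.
HasSum : ∀ {m} → ((Fin m → ℕ) → ℕ) → ℕ → Set
HasSum {m} f s = Σ ℕ λ B →
  (∀ (k : Fin m → ℕ) → (Σ (Fin m) λ i → B < k i) → f k ≡ 0) × (boxSum B f ≡ s)

module Submission where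

-- Proof of Theorem 2.1.  Write Φ(u) for the number of r-regular partitions of n − u
-- (Φ(u) = 0 for u > n).  Removing t copies of a regular part I from a regular partition
-- shows  #{ρ ∈ CP_{r,n} | m_I(ρ) ≥ t} = Φ(t·I)  for t ≥ 1; for I irregular the count is 0.
-- Writing m_j(ρ) = #{t ≥ 1 | m_j(ρ) ≥ t} and |{i | m_i(ρ) ≥ J}| as a sum of indicators
-- and exchanging sums gives
--     V_{j,n} = Σ_{t ≥ 1} Φ(t j),      W_{J,n} = Σ_{x ≥ 1, x regular} Φ(J x).
-- With g(u) = Φ(u j) the theorem becomes  Σ_k Σ_{x regular} g(r^k x) = Σ_t g(t),  which is
-- unique factorisation t = r₁^{k₁}⋯r_m^{k_m}·x with x divisible by no r_i (the r_i being
-- pairwise coprime), proved by sieving out one r_i at a time.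

open import Data.Bool.Base using (if_then_else_)
open import Data.Nat
open import Data.Nat.Properties
import Algebra.Properties.CommutativeSemigroup +-commutativeSemigroup as +-CS
import Algebra.Properties.CommutativeSemigroup *-commutativeSemigroup as *-CS
open import Data.Nat.Divisibility using (_∣_; _∣?_; ∣⇒≤; ∣-refl; ∣-trans; n∣m*n; ∣m+n∣m⇒∣n; ∣m∣n⇒∣m+n)
open import Data.Nat.Coprimality using (Coprime; coprime-divisor)
open import Data.Nat.ListAction using (sum)
open import Data.Nat.ListAction.Properties using (sum-++)
open import Data.Fin using (Fin; zero; suc)
import Data.Fin.Properties as Fin
open import Data.List using (List; []; _∷_; _++_; map; upTo; applyUpTo; filter; concat; concatMap; length)
import Data.List.Properties as List
open import Data.List.Membership.Propositional using (_∈_; _∉_; find)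
open import Data.List.Membership.Propositional.Properties using (∈-filter⁻; ∈-map⁻; ∈-concatMap⁻; ∈-upTo⁻)
open import Data.List.Relation.Unary.All as All using (All; []; _∷_; all?)
open import Data.List.Relation.Unary.Any using (here; there)
open import Data.Vec.Functional using (head; tail) renaming (_∷_ to _∷ᵥ_)
open import Data.Product using (Σ; _×_; _,_; proj₁; proj₂)
open import Relation.Nullary using (¬_; Dec; yes; no; does)
open import Relation.Nullary.Decidable using (dec-true; dec-false; ¬?)
open import Relation.Unary using (Decidable)
open import Relation.Binary.Definitions using (tri<; tri≈; tri>)
open import Relation.Binary.PropositionalEquality
open import Function using (_∘_)
open import Defs

-- The indicator of a decided proposition.  It only inspects the boolean 'does', so it
-- computes on decisions whose boolean computes, e.g. 𝟙 (suc m ≟ suc n) reduces to 𝟙 (m ≟ n).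
𝟙 : ∀ {a} {A : Set a} → Dec A → ℕ
𝟙 d = if does d then 1 else 0

module _ {a} {A : Set a} (d : Dec A) where

  𝟙-yes : A → 𝟙 d ≡ 1
  𝟙-yes x rewrite dec-true d x = refl

  𝟙-no : ¬ A → 𝟙 d ≡ 0
  𝟙-no ¬x rewrite dec-false d ¬x = refl

  𝟙-yes-* : A → ∀ y → 𝟙 d * y ≡ y
  𝟙-yes-* x y rewrite 𝟙-yes x = +-identityʳ y

  𝟙-no-* : ¬ A → ∀ y → 𝟙 d * y ≡ 0
  𝟙-no-* ¬x y rewrite 𝟙-no ¬x = refl

𝟙-cong : ∀ {a b} {A : Set a} {B : Set b} (dA : Dec A) (dB : Dec B) →
         (A → B) → (B → A) → 𝟙 dA ≡ 𝟙 dB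
𝟙-cong (yes x) dB f g = sym (𝟙-yes dB (f x))
𝟙-cong (no ¬x) dB f g = sym (𝟙-no dB (¬x ∘ g))

𝟙-× : ∀ {a b c} {A : Set a} {B : Set b} {C : Set c} (dA : Dec A) (dB : Dec B) (dC : Dec C) →
      (C → A × B) → (A × B → C) → 𝟙 dC ≡ 𝟙 dA * 𝟙 dB
𝟙-× (yes x) (yes y) dC f g = 𝟙-yes dC (g (x , y))
𝟙-× (yes x) (no ¬y) dC f g = 𝟙-no dC (¬y ∘ proj₂ ∘ f)
𝟙-× (no ¬x) dB      dC f g = 𝟙-no dC (¬x ∘ proj₁ ∘ f)

𝟙-split : ∀ {a} {A : Set a} (d : Dec A) y → y ≡ 𝟙 (¬? d) * y + 𝟙 d * y
𝟙-split (yes _) y = sym (+-identityʳ y)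
𝟙-split (no _)  y = sym (trans (+-identityʳ (y + 0)) (+-identityʳ y))

sum-map-cong-∈ : ∀ {a} {A : Set a} {h h′ : A → ℕ} xs →
                 (∀ {x} → x ∈ xs → h x ≡ h′ x) → sum (map h xs) ≡ sum (map h′ xs)
sum-map-cong-∈ []       e = refl
sum-map-cong-∈ (x ∷ xs) e = cong₂ _+_ (e (here refl)) (sum-map-cong-∈ xs (e ∘ there))

sum-map-cong : ∀ {a} {A : Set a} {h h′ : A → ℕ} xs →
               (∀ x → h x ≡ h′ x) → sum (map h xs) ≡ sum (map h′ xs)
sum-map-cong xs e = sum-map-cong-∈ xs (λ {x} _ → e x)

sum-map-zero : ∀ {a} {A : Set a} {h : A → ℕ} xs →
               (∀ {x} → x ∈ xs → h x ≡ 0) → sum (map h xs) ≡ 0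
sum-map-zero []       e = refl
sum-map-zero (x ∷ xs) e = cong₂ _+_ (e (here refl)) (sum-map-zero xs (e ∘ there))

sum-map-scale : ∀ {a} {A : Set a} c (h : A → ℕ) xs →
                sum (map (λ x → c * h x) xs) ≡ c * sum (map h xs)
sum-map-scale c h []       = sym (*-zeroʳ c)
sum-map-scale c h (x ∷ xs) =
  trans (cong (c * h x +_) (sum-map-scale c h xs)) (sym (*-distribˡ-+ c (h x) _))

module _ {a p} {A : Set a} {P : A → Set p} (P? : Decidable P) where

  sum-filter : ∀ (h : A → ℕ) xs →
               sum (map h (filter P? xs)) ≡ sum (map (λ x → 𝟙 (P? x) * h x) xs)
  sum-filter h []       = refl
  sum-filter h (x ∷ xs) with P? x
  ... | yes _ = cong₂ _+_ (sym (+-identityʳ (h x))) (sum-filter h xs)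
  ... | no  _ = sum-filter h xs

  length-filter : ∀ xs → length (filter P? xs) ≡ sum (map (λ x → 𝟙 (P? x)) xs)
  length-filter []       = refl
  length-filter (x ∷ xs) with P? x
  ... | yes _ = cong suc (length-filter xs)
  ... | no  _ = length-filter xs

sum-concatMap : ∀ {a b} {A : Set a} {B : Set b} (h : B → ℕ) (G : A → List B) xs →
  sum (map h (concatMap G xs)) ≡ sum (map (λ x → sum (map h (G x))) xs)
sum-concatMap h G []       = refl
sum-concatMap h G (x ∷ xs) = begin
    sum (map h (G x ++ concatMap G xs))
  ≡⟨ cong sum (List.map-++ h (G x) _) ⟩
    sum (map h (G x) ++ map h (concatMap G xs))
  ≡⟨ sum-++ (map h (G x)) _ ⟩
    sum (map h (G x)) + sum (map h (concatMap G xs))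
  ≡⟨ cong (sum (map h (G x)) +_) (sum-concatMap h G xs) ⟩
    sum (map h (G x)) + sum (map (λ x → sum (map h (G x))) xs) ∎
  where open ≡-Reasoning

Σ< : ℕ → (ℕ → ℕ) → ℕ
Σ< zero    φ = 0
Σ< (suc N) φ = φ 0 + Σ< N (φ ∘ suc)

Σ⁺ : ℕ → (ℕ → ℕ) → ℕ
Σ⁺ N φ = Σ< N (φ ∘ suc)

Σ<-cong : ∀ N {φ ψ} → (∀ x → x < N → φ x ≡ ψ x) → Σ< N φ ≡ Σ< N ψ
Σ<-cong zero    e = refl
Σ<-cong (suc N) e = cong₂ _+_ (e 0 z<s) (Σ<-cong N (λ x x<N → e (suc x) (s<s x<N)))

Σ<-zero : ∀ N {φ} → (∀ x → x < N → φ x ≡ 0) → Σ< N φ ≡ 0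
Σ<-zero zero    e = refl
Σ<-zero (suc N) e = cong₂ _+_ (e 0 z<s) (Σ<-zero N (λ x x<N → e (suc x) (s<s x<N)))

Σ<-+ : ∀ N φ ψ → Σ< N (λ x → φ x + ψ x) ≡ Σ< N φ + Σ< N ψ
Σ<-+ zero    φ ψ = refl
Σ<-+ (suc N) φ ψ = trans (cong (φ 0 + ψ 0 +_) (Σ<-+ N (φ ∘ suc) (ψ ∘ suc)))
                         (+-CS.interchange (φ 0) (ψ 0) (Σ< N (φ ∘ suc)) (Σ< N (ψ ∘ suc)))

Σ<-split : ∀ a b φ → Σ< (a + b) φ ≡ Σ< a φ + Σ< b (λ x → φ (a + x))
Σ<-split zero    b φ = refl
Σ<-split (suc a) b φ =
  trans (cong (φ 0 +_) (Σ<-split a b (φ ∘ suc))) (sym (+-assoc (φ 0) _ _))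

Σ<-snoc : ∀ N φ → Σ< (suc N) φ ≡ Σ< N φ + φ N
Σ<-snoc N φ = begin
    Σ< (suc N) φ
  ≡⟨ cong (λ z → Σ< z φ) (+-comm 1 N) ⟩
    Σ< (N + 1) φ
  ≡⟨ Σ<-split N 1 φ ⟩
    Σ< N φ + (φ (N + 0) + 0)
  ≡⟨ cong (Σ< N φ +_) (trans (+-identityʳ _) (cong φ (+-identityʳ N))) ⟩
    Σ< N φ + φ N ∎
  where open ≡-Reasoning

Σ<-extend : ∀ {n N φ} → n ≤ N → (∀ x → n ≤ x → x < N → φ x ≡ 0) → Σ< N φ ≡ Σ< n φ
Σ<-extend {n} {N} {φ} n≤N e = begin
    Σ< N φ
  ≡⟨ cong (λ z → Σ< z φ) (m+[n∸m]≡n n≤N) ⟨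
    Σ< (n + (N ∸ n)) φ
  ≡⟨ Σ<-split n (N ∸ n) φ ⟩
    Σ< n φ + Σ< (N ∸ n) (λ x → φ (n + x))
  ≡⟨ cong (Σ< n φ +_) (Σ<-zero (N ∸ n) (λ x x<N∸n →
       e (n + x) (m≤m+n n x) (subst (n + x <_) (m+[n∸m]≡n n≤N) (+-monoʳ-< n x<N∸n)))) ⟩
    Σ< n φ + 0
  ≡⟨ +-identityʳ _ ⟩
    Σ< n φ ∎
  where open ≡-Reasoning

Σ<-extract : ∀ {n i} φ → i < n → Σ< n φ ≡ φ i + Σ< n (λ x → 𝟙 (¬? (x ≟ i)) * φ x)
Σ<-extract {suc n} {zero} φ _ =
  cong (φ 0 +_) (Σ<-cong n (λ x _ → sym (+-identityʳ (φ (suc x)))))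
Σ<-extract {suc n} {suc i} φ (s<s i<n) = begin
    φ 0 + Σ< n (φ ∘ suc)
  ≡⟨ cong (φ 0 +_) (Σ<-extract (φ ∘ suc) i<n) ⟩
    φ 0 + (φ (suc i) + R)
  ≡⟨ sym (+-assoc (φ 0) _ R) ⟩
    φ 0 + φ (suc i) + R
  ≡⟨ cong (_+ R) (trans (+-comm (φ 0) _) (cong (φ (suc i) +_) (sym (+-identityʳ (φ 0))))) ⟩
    φ (suc i) + (φ 0 + 0) + R
  ≡⟨ +-assoc (φ (suc i)) _ R ⟩
    φ (suc i) + (φ 0 + 0 + R) ∎
  where
  open ≡-Reasoning
  R = Σ< n (λ x → 𝟙 (¬? (x ≟ i)) * φ (suc x))

sum-applyUpTo : ∀ N (f : ℕ → ℕ) (φ : ℕ → ℕ) → sum (map φ (applyUpTo f N)) ≡ Σ< N (φ ∘ f)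
sum-applyUpTo zero    f φ = refl
sum-applyUpTo (suc N) f φ = cong (φ (f 0) +_) (sum-applyUpTo N (f ∘ suc) φ)

sum-upTo : ∀ N φ → sum (map φ (upTo N)) ≡ Σ< N φ
sum-upTo N = sum-applyUpTo N (λ x → x)

sum-oneTo : ∀ N φ → sum (map φ (oneTo N)) ≡ Σ⁺ N φ
sum-oneTo N φ = trans (cong sum (sym (List.map-∘ (upTo N)))) (sum-upTo N (φ ∘ suc))

sum-Σ<-swap : ∀ {a} {A : Set a} N (F : ℕ → A → ℕ) xs →
  sum (map (λ ρ → Σ< N (λ x → F x ρ)) xs) ≡ Σ< N (λ x → sum (map (F x) xs))
sum-Σ<-swap N F []       = sym (Σ<-zero N (λ _ _ → refl))
sum-Σ<-swap N F (ρ ∷ xs) =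
  trans (cong (Σ< N (λ x → F x ρ) +_) (sum-Σ<-swap N F xs)) (sym (Σ<-+ N (λ x → F x ρ) _))

count-below : ∀ n c → c ≤ n → Σ⁺ n (λ t → 𝟙 (t ≤? c)) ≡ c
count-below zero    .zero   z≤n       = refl
count-below (suc n) zero    _         = Σ<-zero (suc n) (λ _ _ → refl)
count-below (suc n) (suc c) (s≤s c≤n) = cong suc (count-below n c c≤n)

Vanish : ℕ → (ℕ → ℕ) → Set
Vanish n g = ∀ u → n < u → g u ≡ 0

-- Σ_{x ≤ Mq, q ∣ x} g x = Σ_{y ≤ M} g (q y), by splitting [1..Mq] into blocks of length q.
multiples-blocks : ∀ {q} → 1 ≤ q → ∀ M (g : ℕ → ℕ) →
  Σ⁺ (M * q) (λ x → 𝟙 (q ∣? x) * g x) ≡ Σ⁺ M (λ y → g (q * y))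
multiples-blocks         _         zero    g = refl
multiples-blocks {suc q′} (s≤s z≤n) (suc M) g = begin
    Σ< (q + M * q) (φ ∘ suc)
  ≡⟨ Σ<-split q (M * q) (φ ∘ suc) ⟩
    Σ< q (φ ∘ suc) + Σ< (M * q) (λ x → φ (suc (q + x)))
  ≡⟨ cong₂ _+_ first-block (Σ<-cong (M * q) (λ x _ → shift x)) ⟩
    g q + Σ⁺ (M * q) (λ x → 𝟙 (q ∣? x) * g (q + x))
  ≡⟨ cong₂ _+_ (cong g (sym (*-identityʳ q))) (multiples-blocks (s≤s z≤n) M (g ∘ (q +_))) ⟩
    g (q * 1) + Σ⁺ M (λ y → g (q + q * y))
  ≡⟨ cong (g (q * 1) +_) (Σ<-cong M (λ x _ → cong g (sym (*-suc q (suc x))))) ⟩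
    Σ⁺ (suc M) (λ y → g (q * y)) ∎
  where
  open ≡-Reasoning
  q = suc q′
  φ : ℕ → ℕ
  φ x = 𝟙 (q ∣? x) * g x
  -- in the first block only x = q is a multiple of q
  first-block : Σ< q (φ ∘ suc) ≡ g q
  first-block = begin
      Σ< q (φ ∘ suc)
    ≡⟨ Σ<-snoc q′ (φ ∘ suc) ⟩
      Σ< q′ (φ ∘ suc) + φ q
    ≡⟨ cong₂ _+_ (Σ<-zero q′ (λ x x<q′ → 𝟙-no-* (q ∣? suc x) (λ q∣ → <⇒≱ (s<s x<q′) (∣⇒≤ q∣)) _))
                 (𝟙-yes-* (q ∣? q) ∣-refl (g q)) ⟩
      g q ∎
  -- translating by q preserves divisibility by q
  shift : ∀ x → φ (suc (q + x)) ≡ 𝟙 (q ∣? suc x) * g (q + suc x)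
  shift x rewrite sym (+-suc q x) =
    cong (_* g (q + suc x)) (𝟙-cong (q ∣? (q + suc x)) (q ∣? suc x)
      (λ q∣ → ∣m+n∣m⇒∣n q∣ ∣-refl) (∣m∣n⇒∣m+n ∣-refl))

multiples : ∀ {q n g} → 1 ≤ q → Vanish n g →
  Σ⁺ n (λ x → 𝟙 (q ∣? x) * g x) ≡ Σ⁺ n (λ y → g (q * y))
multiples {suc q′} {n} {g} 1≤q vanish = trans
  (sym (Σ<-extend (m≤m*n n (suc q′)) (λ x n≤x _ →
     trans (cong (𝟙 (suc q′ ∣? suc x) *_) (vanish (suc x) (s≤s n≤x))) (*-zeroʳ (𝟙 (suc q′ ∣? suc x))))))
  (multiples-blocks 1≤q n g)

sift-once : ∀ {q n g} → 1 ≤ q → Vanish n g →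
  Σ⁺ n g ≡ Σ⁺ n (λ x → 𝟙 (¬? (q ∣? x)) * g x) + Σ⁺ n (λ y → g (q * y))
sift-once {q} {n} {g} 1≤q vanish = begin
    Σ⁺ n g
  ≡⟨ Σ<-cong n (λ x _ → 𝟙-split (q ∣? suc x) (g (suc x))) ⟩
    Σ⁺ n (λ x → 𝟙 (¬? (q ∣? x)) * g x + 𝟙 (q ∣? x) * g x)
  ≡⟨ Σ<-+ n _ _ ⟩
    Σ⁺ n (λ x → 𝟙 (¬? (q ∣? x)) * g x) + Σ⁺ n (λ x → 𝟙 (q ∣? x) * g x)
  ≡⟨ cong (Σ⁺ n (λ x → 𝟙 (¬? (q ∣? x)) * g x) +_) (multiples 1≤q vanish) ⟩
    Σ⁺ n (λ x → 𝟙 (¬? (q ∣? x)) * g x) + Σ⁺ n (λ y → g (q * y)) ∎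
  where open ≡-Reasoning

n<q^n : ∀ {q} → 2 ≤ q → ∀ n → n < q ^ n
n<q^n {q} 2≤q zero    = s≤s z≤n
n<q^n {q} 2≤q (suc n) = ≤-<-trans (n<q^n 2≤q n) (^-monoʳ-< q 2≤q (n<1+n n))

-- iterated sieving: every x ∈ [1..n] is q^a times a non-multiple of q, with a < B,
-- except for the multiples of q^B
sift-powers : ∀ {q n g} → 1 ≤ q → Vanish n g → ∀ B →
  Σ⁺ n g ≡ Σ< B (λ a → Σ⁺ n (λ x → 𝟙 (¬? (q ∣? x)) * g (q ^ a * x))) + Σ⁺ n (λ y → g (q ^ B * y))
sift-powers {q} {n} {g} 1≤q vanish zero =
  Σ<-cong n (λ x _ → cong g (sym (*-identityˡ (suc x))))
sift-powers {q} {n} {g} 1≤q vanish (suc B) = begin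
    Σ⁺ n g
  ≡⟨ sift-powers 1≤q vanish B ⟩
    Σ< B S + Σ⁺ n (λ y → g (q ^ B * y))
  ≡⟨ cong (Σ< B S +_) (sift-once 1≤q vanish-B) ⟩
    Σ< B S + (S B + Σ⁺ n (λ y → g (q ^ B * (q * y))))
  ≡⟨ +-assoc (Σ< B S) (S B) _ ⟨
    Σ< B S + S B + Σ⁺ n (λ y → g (q ^ B * (q * y)))
  ≡⟨ cong₂ _+_ (sym (Σ<-snoc B S)) (Σ<-cong n (λ x _ → cong g (reassoc (suc x)))) ⟩
    Σ< (suc B) S + Σ⁺ n (λ y → g (q ^ suc B * y)) ∎
  where
  open ≡-Reasoning
  S : ℕ → ℕ
  S a = Σ⁺ n (λ x → 𝟙 (¬? (q ∣? x)) * g (q ^ a * x))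
  vanish-B : Vanish n (λ y → g (q ^ B * y))
  vanish-B u n<u = vanish _ (<-≤-trans n<u (m≤n*m u (q ^ B) {{>-nonZero (m^n>0 q {{>-nonZero 1≤q}} B)}}))
  reassoc : ∀ y → q ^ B * (q * y) ≡ q ^ suc B * y
  reassoc y = trans (sym (*-assoc (q ^ B) q y)) (cong (_* y) (*-comm (q ^ B) q))

sift : ∀ {q n g} → 2 ≤ q → Vanish n g →
  Σ< (suc n) (λ a → Σ⁺ n (λ x → 𝟙 (¬? (q ∣? x)) * g (q ^ a * x))) ≡ Σ⁺ n g
sift {q} {n} {g} 2≤q vanish = sym (begin
    Σ⁺ n g
  ≡⟨ sift-powers (<⇒≤ 2≤q) vanish (suc n) ⟩
    Σ< (suc n) S + Σ⁺ n (λ y → g (q ^ suc n * y))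
  ≡⟨ cong (Σ< (suc n) S +_) (Σ<-zero n (λ x _ → vanish _ (beyond x))) ⟩
    Σ< (suc n) S + 0
  ≡⟨ +-identityʳ _ ⟩
    Σ< (suc n) S ∎)
  where
  open ≡-Reasoning
  S : ℕ → ℕ
  S a = Σ⁺ n (λ x → 𝟙 (¬? (q ∣? x)) * g (q ^ a * x))
  beyond : ∀ x → n < q ^ suc n * suc x
  beyond x = <-≤-trans (<-trans (n<1+n n) (n<q^n 2≤q (suc n))) (m≤m*n (q ^ suc n) (suc x))

coprime-pow-divisor : ∀ {q s} → Coprime q s → ∀ a z → q ∣ s ^ a * z → q ∣ z
coprime-pow-divisor {q}     c zero    z q∣ = subst (q ∣_) (+-identityʳ z) q∣
coprime-pow-divisor {q} {s} c (suc a) z q∣ =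
  coprime-pow-divisor c a z (coprime-divisor c (subst (q ∣_) (*-assoc s (s ^ a) z) q∣))

coprime-prodPow-divisor : ∀ {m q} (r : Fin m → ℕ) → (∀ i → Coprime q (r i)) →
  ∀ k y → q ∣ prodPow r k * y → q ∣ y
coprime-prodPow-divisor {zero}  {q} r c k y q∣ = subst (q ∣_) (+-identityʳ y) q∣
coprime-prodPow-divisor {suc m} {q} r c k y q∣ =
  coprime-prodPow-divisor (tail r) (c ∘ suc) (tail k) y
    (coprime-pow-divisor (c zero) (head k) _ (subst (q ∣_) (*-assoc (head r ^ head k) _ y) q∣))

boxSum-cong : ∀ {m} B {f f′ : (Fin m → ℕ) → ℕ} → (∀ k → f k ≡ f′ k) → boxSum B f ≡ boxSum B f′
boxSum-cong {zero}  B e = e _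
boxSum-cong {suc m} B e = sum-map-cong (upTo (suc B)) (λ a → boxSum-cong B (λ k → e (a ∷ᵥ k)))

PairwiseCoprime : ∀ {m} → (Fin m → ℕ) → Set
PairwiseCoprime r = ∀ i i′ → ¬ (i ≡ i′) → Coprime (r i) (r i′)

-- Unique factorisation x = r₁^{k₁}⋯r_m^{k_m} · x′ with x′ divisible by no r_i, summed:
-- Σ_{k ∈ [0..n]^m} Σ_{x ≤ n, x r-regular} g (r^k x) = Σ_{x ≤ n} g x  for g vanishing beyond n.
-- Induction on m: peel off the factor r₁^{k₁} and sieve by r₁.
box-sift : ∀ {m n g} (r : Fin m → ℕ) → (∀ i → 2 ≤ r i) → PairwiseCoprime r → Vanish n g →
  boxSum n (λ k → Σ⁺ n (λ x → 𝟙 (notDivByAny? r x) * g (prodPow r k * x))) ≡ Σ⁺ n g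
box-sift {zero} {n} {g} r _ _ _ =
  Σ<-cong n (λ x _ → trans (𝟙-yes-* (notDivByAny? r (suc x)) (λ ()) _) (cong g (*-identityˡ (suc x))))
box-sift {suc m} {n} {g} r r≥2 coprime vanish = begin
    boxSum n F
  ≡⟨ sum-upTo (suc n) _ ⟩
    Σ< (suc n) (λ a → boxSum n (λ k → F (a ∷ᵥ k)))
  ≡⟨ Σ<-cong (suc n) (λ a _ →
       trans (boxSum-cong n (λ k → Σ<-cong n (λ x _ → peel a k (suc x))))
             (box-sift (tail r) (r≥2 ∘ suc) coprime-tail (vanish-a a))) ⟩
    Σ< (suc n) (λ a → Σ⁺ n (g-a a))
  ≡⟨ sift (r≥2 zero) vanish ⟩
    Σ⁺ n g ∎
  where
  open ≡-Reasoning
  q = head r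
  F : (Fin (suc m) → ℕ) → ℕ
  F k = Σ⁺ n (λ x → 𝟙 (notDivByAny? r x) * g (prodPow r k * x))
  g-a : ℕ → ℕ → ℕ
  g-a a u = 𝟙 (¬? (q ∣? u)) * g (q ^ a * u)
  vanish-a : ∀ a → Vanish n (g-a a)
  vanish-a a u n<u = trans (cong (𝟙 (¬? (q ∣? u)) *_)
      (vanish _ (<-≤-trans n<u (m≤n*m u (q ^ a) {{>-nonZero (m^n>0 q {{>-nonZero q>0}} a)}}))))
    (*-zeroʳ (𝟙 (¬? (q ∣? u))))
    where q>0 = <-trans z<s (r≥2 zero)
  coprime-tail : PairwiseCoprime (tail r)
  coprime-tail i i′ i≢i′ = coprime (suc i) (suc i′) (i≢i′ ∘ Fin.suc-injective)
  q-coprime : ∀ i → Coprime q (tail r i)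
  q-coprime i = coprime zero (suc i) (λ ())
  -- x is r-regular iff q ∤ r′^k x and x is r′-regular, where r′ = tail r
  peel : ∀ a k x → 𝟙 (notDivByAny? r x) * g (q ^ a * prodPow (tail r) k * x)
                 ≡ 𝟙 (notDivByAny? (tail r) x) * g-a a (prodPow (tail r) k * x)
  peel a k x = begin
      𝟙 (notDivByAny? r x) * g (q ^ a * P * x)
    ≡⟨ cong₂ _*_ (𝟙-× (¬? (q ∣? P * x)) (notDivByAny? (tail r) x) (notDivByAny? r x) split join)
                 (cong g (*-assoc (q ^ a) P x)) ⟩
      𝟙 (¬? (q ∣? P * x)) * 𝟙 (notDivByAny? (tail r) x) * g (q ^ a * (P * x))
    ≡⟨ *-CS.xy∙z≈y∙xz (𝟙 (¬? (q ∣? P * x))) _ _ ⟩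
      𝟙 (notDivByAny? (tail r) x) * g-a a (P * x) ∎
    where
    P = prodPow (tail r) k
    split : NotDivByAny r x → ¬ q ∣ P * x × NotDivByAny (tail r) x
    split reg = (λ q∣ → reg zero (coprime-prodPow-divisor (tail r) q-coprime k x q∣)) , reg ∘ suc
    join : ¬ q ∣ P * x × NotDivByAny (tail r) x → NotDivByAny r x
    join (q∤ , reg′) zero    q∣x = q∤ (∣-trans q∣x (n∣m*n P))
    join (q∤ , reg′) (suc i)     = reg′ i

prodPow-pos : ∀ {m} (r : Fin m → ℕ) → (∀ i → 1 ≤ r i) → ∀ k → 1 ≤ prodPow r k
prodPow-pos {zero}  r r≥1 k = ≤-refl
prodPow-pos {suc m} r r≥1 k =
  *-mono-≤ (m^n>0 (head r) {{>-nonZero (r≥1 zero)}} (head k)) (prodPow-pos (tail r) (r≥1 ∘ suc) (tail k))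

pow≤prodPow : ∀ {m} (r : Fin m → ℕ) → (∀ i → 1 ≤ r i) → ∀ k i → r i ^ k i ≤ prodPow r k
pow≤prodPow {suc m} r r≥1 k zero    =
  m≤m*n (head r ^ head k) (prodPow (tail r) (tail k))
    {{>-nonZero (prodPow-pos (tail r) (r≥1 ∘ suc) (tail k))}}
pow≤prodPow {suc m} r r≥1 k (suc i) =
  ≤-trans (pow≤prodPow (tail r) (r≥1 ∘ suc) (tail k) i)
          (m≤n*m (prodPow (tail r) (tail k)) (head r ^ head k)
            {{>-nonZero (m^n>0 (head r) {{>-nonZero (r≥1 zero)}} (head k))}})

∸-swap : ∀ n a b → n ∸ a ∸ b ≡ n ∸ b ∸ a
∸-swap n a b = trans (∸-+-assoc n a b) (trans (cong (n ∸_) (+-comm a b)) (sym (∸-+-assoc n b a)))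

∸-pos : ∀ {n b p} → n ≤ suc b → 1 ≤ p → n ∸ p ≤ b
∸-pos {n} {b} {suc p} n≤1+b _ = ≤-trans (∸-monoˡ-≤ (suc p) n≤1+b) (m∸n≤m b p)

≤∸⇒+≤ : ∀ {a b n} → b ≤ n → a ≤ n ∸ b → b + a ≤ n
≤∸⇒+≤ {a} {b} {n} b≤n a≤n∸b = subst (_≤ n) (+-comm a b) (m≤o∸n⇒m+n≤o a b≤n a≤n∸b)

+≤⇒≤∸ : ∀ {a b n} → b + a ≤ n → a ≤ n ∸ b
+≤⇒≤∸ {a} {b} {n} b+a≤n = m+n≤o⇒m≤o∸n a (subst (_≤ n) (+-comm b a) b+a≤n)

-- both say a + b ≤ n
∸-flip : ∀ {a b n} → b ≤ n → a ≤ n ∸ b → b ≤ n ∸ a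
∸-flip {a} {b} {n} b≤n a≤n∸b = +≤⇒≤∸ (subst (_≤ n) (+-comm b a) (≤∸⇒+≤ b≤n a≤n∸b))

∈-candidates : ∀ k n {p} → p ∈ filter (λ p → p ≤? k) (oneTo n) → 1 ≤ p × p ≤ n × p ≤ k
∈-candidates k n p∈ with ∈-filter⁻ (λ p → p ≤? k) {xs = oneTo n} p∈
... | p∈oneTo , p≤k with ∈-map⁻ suc p∈oneTo
...   | x , x∈ , refl = s≤s z≤n , ∈-upTo⁻ x∈ , p≤k

partsBounded-fuel : ∀ {f f′} k n → n ≤ f → n ≤ f′ → partsBounded f k n ≡ partsBounded f′ k n
partsBounded-fuel {f}     {f′}     k zero    _         _          = refl
partsBounded-fuel {suc f} {suc f′} k (suc n) (s≤s n≤f) (s≤s n≤f′) =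
  cong concat (List.map-cong-local (All.tabulate (λ p∈ →
    let 1≤p , _ , _ = ∈-candidates k (suc n) p∈
        n+1-p≤n = ∸-monoʳ-≤ (suc n) 1≤p in
    cong (map (_ ∷_)) (partsBounded-fuel _ _ (≤-trans n+1-p≤n n≤f) (≤-trans n+1-p≤n n≤f′)))))

IsPartition : ℕ → ℕ → List ℕ → Set
IsPartition k n ρ = sum ρ ≡ n × All (λ p → 1 ≤ p × p ≤ k) ρ

partsBounded-sound : ∀ f k n {ρ} → ρ ∈ partsBounded f k n → IsPartition k n ρ
partsBounded-sound f       k zero    (here refl) = refl , []
partsBounded-sound (suc f) k (suc n) ρ∈ with find (∈-concatMap⁻ _ {xs = filter (λ p → p ≤? k) (oneTo (suc n))} ρ∈)
... | p , p∈ , ρ∈p with ∈-map⁻ (p ∷_) ρ∈p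
...   | σ , σ∈ , refl with ∈-candidates k (suc n) p∈ | partsBounded-sound f p (suc n ∸ p) σ∈
...     | 1≤p , p≤1+n , p≤k | sumσ , partsσ =
  trans (cong (p +_) sumσ) (m+[n∸m]≡n p≤1+n) ,
  (1≤p , p≤k) ∷ All.map (λ (1≤q , q≤p) → 1≤q , ≤-trans q≤p p≤k) partsσ

∈⇒≤sum : ∀ {p ρ} → p ∈ ρ → p ≤ sum ρ
∈⇒≤sum {ρ = q ∷ ρ} (here refl) = m≤m+n q (sum ρ)
∈⇒≤sum {ρ = q ∷ ρ} (there p∈)  = ≤-trans (∈⇒≤sum p∈) (m≤n+m (sum ρ) q)

length≤sum : ∀ {ρ} → All (1 ≤_) ρ → length ρ ≤ sum ρ
length≤sum []           = z≤n
length≤sum (1≤p ∷ 1≤ρ) = +-mono-≤ 1≤p (length≤sum 1≤ρ)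

mult-here : ∀ I ρ → mult I (I ∷ ρ) ≡ suc (mult I ρ)
mult-here I ρ = cong length (List.filter-accept (λ x → x ≟ I) refl)

mult-there : ∀ {p I} ρ → ¬ p ≡ I → mult I (p ∷ ρ) ≡ mult I ρ
mult-there {I = I} ρ p≢I = cong length (List.filter-reject (λ x → x ≟ I) p≢I)

mult-absent : ∀ {I ρ} → I ∉ ρ → mult I ρ ≡ 0
mult-absent {I} {[]}    I∉ = refl
mult-absent {I} {p ∷ ρ} I∉ =
  trans (mult-there ρ (λ p≡I → I∉ (here (sym p≡I)))) (mult-absent (I∉ ∘ there))

mult≤length : ∀ I ρ → mult I ρ ≤ length ρ
mult≤length I ρ = List.length-filter (λ x → x ≟ I) ρ

atLeast : ℕ → ℕ → List ℕ → ℕ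
atLeast T I ρ = 𝟙 (T ≤? mult I ρ)

atLeast-here : ∀ t I ρ → atLeast (suc t) I (I ∷ ρ) ≡ atLeast t I ρ
atLeast-here t I ρ = trans (cong (λ c → 𝟙 (suc t ≤? c)) (mult-here I ρ))
                            (𝟙-cong (suc t ≤? suc (mult I ρ)) (t ≤? mult I ρ) s≤s⁻¹ s≤s)

atLeast-there : ∀ {p} T I ρ → ¬ p ≡ I → atLeast T I (p ∷ ρ) ≡ atLeast T I ρ
atLeast-there T I ρ p≢I = cong (λ c → 𝟙 (T ≤? c)) (mult-there ρ p≢I)

module Partitions {m : ℕ} (r : Fin m → ℕ) where

  regular? : ∀ x → Dec (NotDivByAny r x)
  regular? = notDivByAny? r

  allRegular? : ∀ ρ → Dec (All (NotDivByAny r) ρ)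
  allRegular? = all? regular?

  -- r-regular partitions of n with all parts ≤ k; CP r n = CPᵇ n n
  CPᵇ : ℕ → ℕ → List (List ℕ)
  CPᵇ k n = filter allRegular? (partsBounded n k n)

  Σᴾ : ℕ → ℕ → (List ℕ → ℕ) → ℕ
  Σᴾ k n h = sum (map h (CPᵇ k n))

  Σᴾ-cong : ∀ k n {h h′} → (∀ {ρ} → ρ ∈ CPᵇ k n → h ρ ≡ h′ ρ) → Σᴾ k n h ≡ Σᴾ k n h′
  Σᴾ-cong k n = sum-map-cong-∈ (CPᵇ k n)

  part-bounds : ∀ k n {ρ I} → ρ ∈ CPᵇ k n → I ∈ ρ → I ≤ k × I ≤ n × NotDivByAny r I
  part-bounds k n ρ∈ I∈ with ∈-filter⁻ allRegular? {xs = partsBounded n k n} ρ∈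
  ... | ρ∈′ , regular with partsBounded-sound n k n ρ∈′
  ...   | refl , parts = proj₂ (All.lookup parts I∈) , ∈⇒≤sum I∈ , All.lookup regular I∈

  -- a multiplicity is at most the number of parts, hence at most n
  mult≤n : ∀ k n {ρ} I → ρ ∈ CPᵇ k n → mult I ρ ≤ n
  mult≤n k n {ρ} I ρ∈ with partsBounded-sound n k n (proj₁ (∈-filter⁻ allRegular? {xs = partsBounded n k n} ρ∈))
  ... | refl , parts = ≤-trans (mult≤length I ρ) (length≤sum (All.map proj₁ parts))

  atLeast-absent : ∀ k n t I → (∀ {ρ} → ρ ∈ CPᵇ k n → I ∉ ρ) → Σᴾ k n (atLeast (suc t) I) ≡ 0
  atLeast-absent k n t I absent =
    sum-map-zero (CPᵇ k n) (λ ρ∈ → cong (λ c → 𝟙 (suc t ≤? c)) (mult-absent (absent ρ∈)))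

  sum-prepend : ∀ p (h : List ℕ → ℕ) ys →
    sum (map (λ ρ → 𝟙 (allRegular? ρ) * h ρ) (map (p ∷_) ys))
      ≡ 𝟙 (regular? p) * sum (map (h ∘ (p ∷_)) (filter allRegular? ys))
  sum-prepend p h ys = begin
      sum (map (λ ρ → 𝟙 (allRegular? ρ) * h ρ) (map (p ∷_) ys))
    ≡⟨ cong sum (List.map-∘ ys) ⟨
      sum (map (λ σ → 𝟙 (allRegular? (p ∷ σ)) * h (p ∷ σ)) ys)
    ≡⟨ sum-map-cong ys (λ σ → trans
         (cong (_* h (p ∷ σ)) (𝟙-× (regular? p) (allRegular? σ) (allRegular? (p ∷ σ))
                                  (λ { (a ∷ b) → a , b }) (λ (a , b) → a ∷ b)))
         (*-assoc (𝟙 (regular? p)) _ _)) ⟩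
      sum (map (λ σ → 𝟙 (regular? p) * (𝟙 (allRegular? σ) * h (p ∷ σ))) ys)
    ≡⟨ sum-map-scale (𝟙 (regular? p)) _ ys ⟩
      𝟙 (regular? p) * sum (map (λ σ → 𝟙 (allRegular? σ) * h (p ∷ σ)) ys)
    ≡⟨ cong (𝟙 (regular? p) *_) (sum-filter allRegular? (h ∘ (p ∷_)) ys) ⟨
      𝟙 (regular? p) * sum (map (h ∘ (p ∷_)) (filter allRegular? ys)) ∎
    where open ≡-Reasoning

  -- decomposition according to the largest part p
  Σᴾ-largest : ∀ k n h → Σᴾ k (suc n) h ≡
    Σ⁺ (suc n) (λ p → 𝟙 (p ≤? k) * (𝟙 (regular? p) * Σᴾ p (suc n ∸ p) (h ∘ (p ∷_))))
  Σᴾ-largest k n h = begin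
      sum (map h (filter allRegular? (concatMap G L)))
    ≡⟨ sum-filter allRegular? h (concatMap G L) ⟩
      sum (map (λ ρ → 𝟙 (allRegular? ρ) * h ρ) (concatMap G L))
    ≡⟨ sum-concatMap _ G L ⟩
      sum (map (λ p → sum (map (λ ρ → 𝟙 (allRegular? ρ) * h ρ) (G p))) L)
    ≡⟨ sum-map-cong-∈ L (λ {p} p∈ → trans (sum-prepend p h (partsBounded n p (suc n ∸ p)))
         (cong (λ ys → 𝟙 (regular? p) * sum (map (h ∘ (p ∷_)) (filter allRegular? ys))) (fuel p∈))) ⟩
      sum (map (λ p → 𝟙 (regular? p) * Σᴾ p (suc n ∸ p) (h ∘ (p ∷_))) L)
    ≡⟨ sum-filter (λ p → p ≤? k) _ (oneTo (suc n)) ⟩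
      sum (map (λ p → 𝟙 (p ≤? k) * (𝟙 (regular? p) * Σᴾ p (suc n ∸ p) (h ∘ (p ∷_)))) (oneTo (suc n)))
    ≡⟨ sum-oneTo (suc n) _ ⟩
      Σ⁺ (suc n) (λ p → 𝟙 (p ≤? k) * (𝟙 (regular? p) * Σᴾ p (suc n ∸ p) (h ∘ (p ∷_)))) ∎
    where
    open ≡-Reasoning
    L = filter (λ p → p ≤? k) (oneTo (suc n))
    G : ℕ → List (List ℕ)
    G p = map (p ∷_) (partsBounded n p (suc n ∸ p))
    fuel : ∀ {p} → p ∈ L → partsBounded n p (suc n ∸ p) ≡ partsBounded (suc n ∸ p) p (suc n ∸ p)
    fuel {p} p∈ = partsBounded-fuel {n} {suc n ∸ p} p (suc n ∸ p)
      (∸-monoʳ-≤ (suc n) (proj₁ (∈-candidates k (suc n) p∈))) ≤-refl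

  branch : ℕ → ℕ → (List ℕ → ℕ) → ℕ → ℕ
  branch k n h p = 𝟙 (p ≤? n) * (𝟙 (p ≤? k) * (𝟙 (regular? p) * Σᴾ p (n ∸ p) (h ∘ (p ∷_))))

  Σᴾ-unfold : ∀ k n {N} h → n ≤ N → Σᴾ k n h ≡ 𝟙 (n ≟ 0) * h [] + Σ⁺ N (branch k n h)
  Σᴾ-unfold k zero    {N} h _ =
    sym (trans (cong (h [] + 0 +_) (Σ<-zero N (λ _ _ → refl))) (+-identityʳ _))
  Σᴾ-unfold k (suc n) {N} h n<N = begin
      Σᴾ k (suc n) h
    ≡⟨ Σᴾ-largest k n h ⟩
      Σ⁺ (suc n) (λ p → 𝟙 (p ≤? k) * (𝟙 (regular? p) * Σᴾ p (suc n ∸ p) (h ∘ (p ∷_))))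
    ≡⟨ Σ<-cong (suc n) {X ∘ suc} (λ x x≤n → sym (𝟙-yes-* (suc x ≤? suc n) x≤n _)) ⟩
      Σ⁺ (suc n) (branch k (suc n) h)
    ≡⟨ Σ<-extend n<N (λ x n<x _ → 𝟙-no-* (suc x ≤? suc n) (<⇒≱ (s≤s n<x)) _) ⟨
      Σ⁺ N (branch k (suc n) h) ∎
    where
    open ≡-Reasoning
    X : ℕ → ℕ
    X p = 𝟙 (p ≤? k) * (𝟙 (regular? p) * Σᴾ p (suc n ∸ p) (h ∘ (p ∷_)))

  branch-off-n : ∀ {k n h p} → ¬ p ≤ n → branch k n h p ≡ 0
  branch-off-n {p = p} p≰n = 𝟙-no-* (p ≤? _) p≰n _

  branch-off-k : ∀ {k n h p} → ¬ p ≤ k → branch k n h p ≡ 0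
  branch-off-k {k} {n} {p = p} p≰k =
    trans (cong (𝟙 (p ≤? n) *_) (𝟙-no-* (p ≤? k) p≰k _)) (*-zeroʳ (𝟙 (p ≤? n)))

  branch-vanish : ∀ {k n h p} → Σᴾ p (n ∸ p) (h ∘ (p ∷_)) ≡ 0 → branch k n h p ≡ 0
  branch-vanish {k} {n} {p = p} Σ≡0 = begin
      𝟙 (p ≤? n) * (𝟙 (p ≤? k) * (𝟙 (regular? p) * _))
    ≡⟨ cong (λ z → 𝟙 (p ≤? n) * (𝟙 (p ≤? k) * (𝟙 (regular? p) * z))) Σ≡0 ⟩
      𝟙 (p ≤? n) * (𝟙 (p ≤? k) * (𝟙 (regular? p) * 0))
    ≡⟨ cong (λ z → 𝟙 (p ≤? n) * (𝟙 (p ≤? k) * z)) (*-zeroʳ (𝟙 (regular? p))) ⟩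
      𝟙 (p ≤? n) * (𝟙 (p ≤? k) * 0)
    ≡⟨ cong (𝟙 (p ≤? n) *_) (*-zeroʳ (𝟙 (p ≤? k))) ⟩
      𝟙 (p ≤? n) * 0
    ≡⟨ *-zeroʳ (𝟙 (p ≤? n)) ⟩
      0 ∎
    where open ≡-Reasoning

  branch-bound : ∀ {k k′ n h p} → p ≤ k → p ≤ k′ → branch k n h p ≡ branch k′ n h p
  branch-bound {k} {k′} {n} {p = p} p≤k p≤k′ =
    cong (λ z → 𝟙 (p ≤? n) * (z * _)) (trans (𝟙-yes (p ≤? k) p≤k) (sym (𝟙-yes (p ≤? k′) p≤k′)))

  branch-cong : ∀ {k n n′ h h′ p} → (p ≤ n → p ≤ n′) → (p ≤ n′ → p ≤ n) →
    Σᴾ p (n ∸ p) (h ∘ (p ∷_)) ≡ Σᴾ p (n′ ∸ p) (h′ ∘ (p ∷_)) → branch k n h p ≡ branch k n′ h′ p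
  branch-cong {k} {n} {n′} {p = p} to from Σ≡ =
    cong₂ _*_ (𝟙-cong (p ≤? n) (p ≤? n′) to from)
              (cong (λ z → 𝟙 (p ≤? k) * (𝟙 (regular? p) * z)) Σ≡)

  -- Removing one copy of the part I = suc i: the members of CPᵇ k n with at least t+1
  -- parts equal to I correspond to the members of CPᵇ k (n − I) with at least t of them.
  -- Induction on a bound b ≥ n, comparing the largest-part decompositions of both sides.
  remove-one : ∀ b {k n} t i → n ≤ b → NotDivByAny r (suc i) → suc i ≤ k → suc i ≤ n →
    Σᴾ k n (atLeast (suc t) (suc i)) ≡ Σᴾ k (n ∸ suc i) (atLeast t (suc i))
  remove-one zero {n = zero} t i _ _ _ ()
  remove-one (suc b) {k} {n} t i n≤b regI I≤k I≤n = begin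
      Σᴾ k n h⁺
    ≡⟨ Σᴾ-unfold k n h⁺ ≤-refl ⟩
      𝟙 (n ≟ 0) * 0 + Σ⁺ n (branch k n h⁺)
    ≡⟨ cong (_+ Σ⁺ n (branch k n h⁺)) (*-zeroʳ (𝟙 (n ≟ 0))) ⟩
      Σ⁺ n (branch k n h⁺)
    ≡⟨ Σ<-extract (branch k n h⁺ ∘ suc) I≤n ⟩
      branch k n h⁺ I + Σ⁺ n others
    ≡⟨ cong (_+ Σ⁺ n others) branch-at-I ⟩
      Σᴾ I M h + Σ⁺ n others
    ≡⟨ cong (_+ Σ⁺ n others) (Σᴾ-unfold I M h M≤n) ⟩
      𝟙 (M ≟ 0) * h [] + Σ⁺ n (branch I M h) + Σ⁺ n others
    ≡⟨ +-assoc (𝟙 (M ≟ 0) * h []) _ _ ⟩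
      𝟙 (M ≟ 0) * h [] + (Σ⁺ n (branch I M h) + Σ⁺ n others)
    ≡⟨ cong (𝟙 (M ≟ 0) * h [] +_) (trans (sym (Σ<-+ n _ _))
         (Σ<-cong n (λ x x<n → combine (suc x) (s≤s z≤n) x<n))) ⟩
      𝟙 (M ≟ 0) * h [] + Σ⁺ n (branch k M h)
    ≡⟨ Σᴾ-unfold k M h M≤n ⟨
      Σᴾ k M h ∎
    where
    open ≡-Reasoning
    I = suc i
    M = n ∸ I
    M≤n = m∸n≤m n I
    h⁺ h : List ℕ → ℕ
    h⁺ = atLeast (suc t) I
    h  = atLeast t I
    others : ℕ → ℕ
    others p = 𝟙 (¬? (p ≟ I)) * branch k n h⁺ p
    -- a part p ≠ I does not affect the multiplicity of I
    skip : ∀ p n′ T → ¬ p ≡ I → Σᴾ p n′ (atLeast T I ∘ (p ∷_)) ≡ Σᴾ p n′ (atLeast T I)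
    skip p n′ T p≢I = Σᴾ-cong p n′ (λ {ρ} _ → atLeast-there T I ρ p≢I)
    -- largest part I: remove it
    branch-at-I : branch k n h⁺ I ≡ Σᴾ I M h
    branch-at-I = begin
        𝟙 (I ≤? n) * (𝟙 (I ≤? k) * (𝟙 (regular? I) * Σᴾ I M (h⁺ ∘ (I ∷_))))
      ≡⟨ trans (𝟙-yes-* (I ≤? n) I≤n _) (trans (𝟙-yes-* (I ≤? k) I≤k _) (𝟙-yes-* (regular? I) regI _)) ⟩
        Σᴾ I M (h⁺ ∘ (I ∷_))
      ≡⟨ Σᴾ-cong I M (λ {ρ} _ → atLeast-here t I ρ) ⟩
        Σᴾ I M h ∎
    -- largest part p > I: remove a copy of I further down (induction hypothesis)
    larger : ∀ p → 1 ≤ p → p ≤ n → I < p → branch k n h⁺ p ≡ branch k M h p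
    larger p 1≤p p≤n I<p with I ≤? n ∸ p
    ... | yes I≤n∸p =
      branch-cong {k} {n} {M} {h⁺} {h} {p} (λ _ → ∸-flip p≤n I≤n∸p) (λ _ → p≤n) (begin
          Σᴾ p (n ∸ p) (h⁺ ∘ (p ∷_))
        ≡⟨ skip p (n ∸ p) (suc t) p≢I ⟩
          Σᴾ p (n ∸ p) h⁺
        ≡⟨ remove-one b t i (∸-pos n≤b 1≤p) regI (<⇒≤ I<p) I≤n∸p ⟩
          Σᴾ p (n ∸ p ∸ I) h
        ≡⟨ cong (λ z → Σᴾ p z h) (∸-swap n p I) ⟩
          Σᴾ p (M ∸ p) h
        ≡⟨ skip p (M ∸ p) t p≢I ⟨
          Σᴾ p (M ∸ p) (h ∘ (p ∷_)) ∎)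
      where p≢I = >⇒≢ I<p
    ... | no I≰n∸p =
      trans (branch-vanish {k} {n} {h⁺} {p} (trans (skip p (n ∸ p) (suc t) (>⇒≢ I<p)) no-I))
            (sym (branch-off-n {k} {M} {h} {p} (λ p≤M → I≰n∸p (∸-flip I≤n p≤M))))
      where
      -- the parts of a partition of n − p are ≤ n − p < I
      no-I : Σᴾ p (n ∸ p) h⁺ ≡ 0
      no-I = atLeast-absent p (n ∸ p) t I (λ ρ∈ I∈ → I≰n∸p (proj₁ (proj₂ (part-bounds p (n ∸ p) ρ∈ I∈))))
    combine : ∀ p → 1 ≤ p → p ≤ n → branch I M h p + others p ≡ branch k M h p
    combine p 1≤p p≤n with <-cmp p I
    -- largest part p < I: no copy of I at all
    ... | tri< p<I _ _ =
      trans (cong₂ _+_ (branch-bound {I} {k} {M} {h} {p} (<⇒≤ p<I) (≤-trans (<⇒≤ p<I) I≤k)) others≡0)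
            (+-identityʳ _)
      where
      no-I : Σᴾ p (n ∸ p) h⁺ ≡ 0
      no-I = atLeast-absent p (n ∸ p) t I (λ ρ∈ I∈ → <⇒≱ p<I (proj₁ (part-bounds p (n ∸ p) ρ∈ I∈)))
      others≡0 : others p ≡ 0
      others≡0 = trans (cong (𝟙 (¬? (p ≟ I)) *_)
                   (branch-vanish {k} {n} {h⁺} {p} (trans (skip p (n ∸ p) (suc t) (<⇒≢ p<I)) no-I)))
                 (*-zeroʳ (𝟙 (¬? (p ≟ I))))
    -- p = I: only the first decomposition has this term
    ... | tri≈ _ refl _ =
      trans (cong₂ _+_ (branch-bound {I} {k} {M} {h} {I} ≤-refl I≤k)
                       (𝟙-no-* (¬? (I ≟ I)) (λ I≢I → I≢I refl) _))
            (+-identityʳ _)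
    -- p > I: only the second one has this term
    ... | tri> _ _ I<p =
      trans (cong₂ _+_ (branch-off-k {I} {M} {h} {p} (<⇒≱ I<p)) (𝟙-yes-* (¬? (p ≟ I)) (>⇒≢ I<p) _))
            (larger p 1≤p p≤n I<p)

  one : List ℕ → ℕ
  one _ = 1

  -- #{ρ ∈ CPᵇ k n | m_I(ρ) ≥ t+1} = #CPᵇ k (n − (t+1) I) for a regular part I with (t+1) I ≤ n
  -- (and 0 if (t+1) I > n): remove t+1 copies of I one at a time.
  atLeast-count : ∀ t i {k n} → n ≤ k → NotDivByAny r (suc i) →
    Σᴾ k n (atLeast (suc t) (suc i)) ≡ 𝟙 (suc t * suc i ≤? n) * Σᴾ k (n ∸ suc t * suc i) one
  atLeast-count t i {k} {n} n≤k regI with suc i ≤? n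
  ... | no I≰n = trans
        (atLeast-absent k n t (suc i) (λ ρ∈ I∈ → I≰n (proj₁ (proj₂ (part-bounds k n ρ∈ I∈)))))
        (sym (𝟙-no-* (suc t * suc i ≤? n) (λ le → I≰n (≤-trans (m≤m+n (suc i) (t * suc i)) le)) _))
  ... | yes I≤n = trans (remove-one n t i ≤-refl regI (≤-trans I≤n n≤k) I≤n) (remaining t)
    where
    I = suc i
    remaining : ∀ t → Σᴾ k (n ∸ I) (atLeast t I) ≡ 𝟙 (suc t * I ≤? n) * Σᴾ k (n ∸ suc t * I) one
    remaining zero = sym (trans (𝟙-yes-* (1 * I ≤? n) (subst (_≤ n) (sym (*-identityˡ I)) I≤n) _)
                                (cong (λ z → Σᴾ k (n ∸ z) one) (*-identityˡ I)))
    remaining (suc t) = begin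
        Σᴾ k (n ∸ I) (atLeast (suc t) I)
      ≡⟨ atLeast-count t i (≤-trans (m∸n≤m n I) n≤k) regI ⟩
        𝟙 (suc t * I ≤? n ∸ I) * Σᴾ k (n ∸ I ∸ suc t * I) one
      ≡⟨ cong₂ _*_ (𝟙-cong (suc t * I ≤? n ∸ I) (I + suc t * I ≤? n) (≤∸⇒+≤ I≤n) (+≤⇒≤∸ {b = I}))
                   (cong (λ z → Σᴾ k z one) (∸-+-assoc n I (suc t * I))) ⟩
        𝟙 (suc (suc t) * I ≤? n) * Σᴾ k (n ∸ suc (suc t) * I) one ∎
      where open ≡-Reasoning

  Φ : ℕ → ℕ → ℕ
  Φ n u = 𝟙 (u ≤? n) * Σᴾ n (n ∸ u) one

  Φ-vanish : ∀ n → Vanish n (Φ n)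
  Φ-vanish n u n<u = 𝟙-no-* (u ≤? n) (<⇒≱ n<u) _

  copies : ∀ n T I → 1 ≤ T → 1 ≤ I → Σᴾ n n (atLeast T I) ≡ 𝟙 (regular? I) * Φ n (T * I)
  copies n (suc t) (suc i) _ _ with regular? (suc i)
  ... | yes regI = trans (atLeast-count t i {n} {n} ≤-refl regI) (sym (𝟙-yes-* (regular? (suc i)) regI _))
  ... | no ¬regI = trans
        (atLeast-absent n n t (suc i) (λ ρ∈ I∈ → ¬regI (proj₂ (proj₂ (part-bounds n n ρ∈ I∈)))))
        (sym (𝟙-no-* (regular? (suc i)) ¬regI _))

  W-formula : ∀ J n → 1 ≤ J → W r J n ≡ Σ⁺ n (λ p → 𝟙 (regular? p) * Φ n (J * p))
  W-formula J n 1≤J = begin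
      Σᴾ n n (numMultGe n J)
    ≡⟨ Σᴾ-cong n n (λ {ρ} _ → trans (length-filter (λ i → J ≤? mult i ρ) (oneTo n)) (sum-oneTo n _)) ⟩
      Σᴾ n n (λ ρ → Σ⁺ n (λ p → atLeast J p ρ))
    ≡⟨ sum-Σ<-swap n (λ x → atLeast J (suc x)) (CPᵇ n n) ⟩
      Σ⁺ n (λ p → Σᴾ n n (atLeast J p))
    ≡⟨ Σ<-cong n (λ x _ → copies n J (suc x) 1≤J (s≤s z≤n)) ⟩
      Σ⁺ n (λ p → 𝟙 (regular? p) * Φ n (J * p)) ∎
    where open ≡-Reasoning

  -- W_{J,n} = 0 for J > n: no part can occur J times
  W-vanish : ∀ J n → n < J → W r J n ≡ 0
  W-vanish J n n<J = trans (W-formula J n (<-≤-trans z<s n<J)) (Σ<-zero n (λ x _ →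
    trans (cong (𝟙 (regular? (suc x)) *_) (Φ-vanish n (J * suc x) (<-≤-trans n<J (m≤m*n J (suc x)))))
          (*-zeroʳ (𝟙 (regular? (suc x))))))

  -- V_{j,n} = Σ_{t ≤ n} Φ n (t j) for regular j, writing m_j(ρ) = #{t ≤ n | t ≤ m_j(ρ)}
  V-formula : ∀ j n → 1 ≤ j → NotDivByAny r j → V r j n ≡ Σ⁺ n (λ t → Φ n (t * j))
  V-formula j n 1≤j regj = begin
      Σᴾ n n (mult j)
    ≡⟨ Σᴾ-cong n n (λ {ρ} ρ∈ → sym (count-below n (mult j ρ) (mult≤n n n j ρ∈))) ⟩
      Σᴾ n n (λ ρ → Σ⁺ n (λ t → atLeast t j ρ))
    ≡⟨ sum-Σ<-swap n (λ x → atLeast (suc x) j) (CPᵇ n n) ⟩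
      Σ⁺ n (λ t → Σᴾ n n (atLeast t j))
    ≡⟨ Σ<-cong n (λ x _ → trans (copies n (suc x) j (s≤s z≤n) 1≤j) (𝟙-yes-* (regular? j) regj _)) ⟩
      Σ⁺ n (λ t → Φ n (t * j)) ∎
    where open ≡-Reasoning

theorem2p1 : (m : ℕ) → 1 ≤ m → (r : Fin m → ℕ) → (∀ i → 2 ≤ r i) →
    (∀ i i′ → ¬ (i ≡ i′) → Coprime (r i) (r i′)) →
    (j n : ℕ) → 1 ≤ j → NotDivByAny r j →
    HasSum (λ k → W r (prodPow r k Data.Nat.* j) n) (V r j n)
theorem2p1 m _ r r≥2 coprime j n 1≤j regj = n , outside , inside
  where
  open Partitions r
  r≥1 : ∀ i → 1 ≤ r i
  r≥1 i = <⇒≤ (r≥2 i)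
  -- W_{r^k j} sums g over the regular x, where g u = Φ n (u j)
  g : ℕ → ℕ
  g u = Φ n (u * j)
  vanish : Vanish n g
  vanish u n<u = Φ-vanish n (u * j) (<-≤-trans n<u (m≤m*n u j {{>-nonZero 1≤j}}))
  1≤J : ∀ k → 1 ≤ prodPow r k * j
  1≤J k = *-mono-≤ (prodPow-pos r r≥1 k) 1≤j
  W-as-g : ∀ k → W r (prodPow r k * j) n ≡ Σ⁺ n (λ x → 𝟙 (regular? x) * g (prodPow r k * x))
  W-as-g k = trans (W-formula (prodPow r k * j) n (1≤J k)) (Σ<-cong n (λ x _ →
    cong (λ u → 𝟙 (regular? (suc x)) * Φ n u) (*-CS.xy∙z≈xz∙y (prodPow r k) j (suc x))))
  -- W_{r^k j} = 0 as soon as some k_i > n, since then r^k j > n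
  outside : ∀ k → Σ (Fin m) (λ i → n < k i) → W r (prodPow r k * j) n ≡ 0
  outside k (i , n<kᵢ) = W-vanish _ n (begin-strict
      n                <⟨ n<kᵢ ⟩
      k i              <⟨ n<q^n (r≥2 i) (k i) ⟩
      r i ^ k i        ≤⟨ pow≤prodPow r r≥1 k i ⟩
      prodPow r k      ≤⟨ m≤m*n (prodPow r k) j {{>-nonZero 1≤j}} ⟩
      prodPow r k * j  ∎)
    where open ≤-Reasoning
  inside : boxSum n (λ k → W r (prodPow r k * j) n) ≡ V r j n
  inside = begin
    boxSum n (λ k → W r (prodPow r k * j) n)                          ≡⟨ boxSum-cong n W-as-g ⟩
    boxSum n (λ k → Σ⁺ n (λ x → 𝟙 (regular? x) * g (prodPow r k * x))) ≡⟨ box-sift r r≥2 coprime vanish ⟩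
    Σ⁺ n g                                                            ≡⟨ V-formula j n 1≤j regj ⟨
    V r j n                                                           ∎
    where open ≡-Reasoning
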